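{- Let $t$ be a positive integer, let $M$ be a $t$-spike of order $r$ with associated partition $(A_1,\dots,A_r)$, and let $C$ be a circuit of $M$. Then either (i) $C=\bigcup_{j\in J}A_j$ for some $t$-element set $J\subseteq\{1,\dots,r\}$, or (ii) $|\{i\in\{1,\dots,r\}: A_i\cap C\ne\emptyset\}|\ge r-(t-2)$ and $|\{i\in\{1,\dots,r\}: A_i\subseteq C\}|<t$.
   Context: A matroid $M$ is a $t$-spike of order $r$ (with $r\ge t$) if there is a partition $(A_1,\dots,A_r)$ of $E(M)$ (the associated partition) into 2-element sets such that for every $t$-element $J\subseteq\{1,\dots,r\}$, the set $\bigcup_{j\in J}A_j$ is both a circuit and a cocircuit of $M$. -}

module Defs where

open import Data.Nat using (ℕ; _≤_; _<_; _+_)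
open import Data.Fin using (Fin; _≟_)
open import Data.Fin.Subset using (Subset; ⊥; _⊆_; _∈_; _∪_; _∩_; ∁; ⁅_⁆; Nonempty; ∣_∣)
open import Data.Fin.Subset.Properties using (nonempty?; _⊆?_)
open import Data.Vec using (tabulate; lookup)
open import Data.Product using (Σ; ∃; _×_)
open import Relation.Binary.PropositionalEquality using (_≡_; _≢_)
open import Relation.Nullary using (¬_)
open import Relation.Nullary.Decidable using (⌊_⌋)

_minus_ : ∀ {n} → Subset n → Fin n → Subset n
X minus e = X ∩ ∁ ⁅ e ⁆

record Matroid (n : ℕ) : Set₁ where
  field
    IsCircuit : Subset n → Set
    C1 : ¬ IsCircuit ⊥
    C2 : ∀ C D → IsCircuit C → IsCircuit D → C ⊆ D → C ≡ D
    C3 : ∀ C D e → IsCircuit C → IsCircuit D → C ≢ D → e ∈ C → e ∈ D →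
         ∃ λ F → IsCircuit F × F ⊆ ((C ∪ D) minus e)

module _ {n : ℕ} (M : Matroid n) where
  open Matroid M

  Independent : Subset n → Set
  Independent I = ∀ C → IsCircuit C → ¬ (C ⊆ I)

  IsBasis : Subset n → Set
  IsBasis B = Independent B × (∀ I → Independent I → B ⊆ I → I ≡ B)

  MeetsAllBases : Subset n → Set
  MeetsAllBases D = ∀ B → IsBasis B → Nonempty (D ∩ B)

  -- cocircuit: minimal set meeting every basis (circuit of the dual)
  IsCocircuit : Subset n → Set
  IsCocircuit D = MeetsAllBases D × (∀ D' → MeetsAllBases D' → D' ⊆ D → D' ≡ D)

-- For a partition encoded by p : Fin n → Fin r, the block A_i = p⁻¹(i)
block : ∀ {n r} → (Fin n → Fin r) → Fin r → Subset n
block p i = tabulate (λ e → ⌊ p e ≟ i ⌋)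

blockUnion : ∀ {n r} → (Fin n → Fin r) → Subset r → Subset n
blockUnion p J = tabulate (λ e → lookup J (p e))

record IsSpike {n : ℕ} (M : Matroid n) (t r : ℕ) (p : Fin n → Fin r) : Set where
  field
    t≤r : t ≤ r
    blocks-pairs : ∀ i → ∣ block p i ∣ ≡ 2
    spike-circ : ∀ (J : Subset r) → ∣ J ∣ ≡ t → Matroid.IsCircuit M (blockUnion p J)
    spike-cocirc : ∀ (J : Subset r) → ∣ J ∣ ≡ t → IsCocircuit M (blockUnion p J)

numMeeting : ∀ {n r} → (Fin n → Fin r) → Subset n → ℕ
numMeeting {r = r} p C = ∣ tabulate {n = r} (λ i → ⌊ nonempty? (block p i ∩ C) ⌋) ∣

numContained : ∀ {n r} → (Fin n → Fin r) → Subset n → ℕ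
numContained {r = r} p C = ∣ tabulate {n = r} (λ i → ⌊ block p i ⊆? C ⌋) ∣

module Submission where

-- Let X be the set of blocks A_i contained in the circuit C, Y the set of
-- blocks meeting C. If |X| ≥ t, then C contains the circuit A_J for a
-- t-subset J of X, so C = A_J by minimality: outcome (i). If some A_i meets C
-- without lying in C while fewer than r - (t - 2) blocks meet C, a t-set J
-- containing i whose other indices avoid Y makes C meet the cocircuit A_J in
-- one element only, contradicting orthogonality. So if |X| < t, either
-- |Y| ≥ r - (t - 2), outcome (ii), or C is a union of blocks, C ⊆ A_J for a
-- t-set J ⊇ X, and C = A_J by minimality.
-- Orthogonality is derived from the circuit axioms by basis exchange: a basis
-- B with B ∩ D ⊆ {e} can always be exchanged for one missing fewer elements
-- of C, so D - e meets every basis, against minimality of the cocircuit D.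

open import Defs
open import Data.Nat using (ℕ; zero; suc; _≤_; _<_; _+_; _∸_; _≤?_; z≤n; s≤s; s≤s⁻¹)
open import Data.Nat.Properties using (≤-trans; ≰⇒>; <⇒≤; +-comm; +-∸-assoc; m+n≤o⇒m≤o∸n)
open import Data.Nat.Induction using (<-rec)
open import Data.Fin using (Fin; zero; suc; _≟_)
open import Data.Fin.Subset
  using (Subset; ∣_∣; _⊆_; _∈_; _∉_; _∪_; _∩_; ∁; ⁅_⁆; ⊤; inside; outside)
  renaming (⊥ to ∅)
open import Data.Fin.Subset.Properties
open import Data.Vec using (_∷_; []; tabulate; lookup; here; there)
open import Data.Vec.Properties using (lookup∘tabulate; []=⇒lookup; lookup⇒[]=)
open import Data.Bool using (true)
open import Data.Product using (∃; _×_; _,_; proj₁; proj₂)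
open import Data.Sum using (_⊎_; inj₁; inj₂)
open import Data.Empty using (⊥; ⊥-elim)
open import Function using (_∘_)
open import Relation.Binary.PropositionalEquality using (_≡_; _≢_; refl; sym; trans; cong; subst; subst₂)
open import Relation.Nullary using (¬_; Dec; yes; no)
open import Relation.Nullary.Decidable using (⌊_⌋; decidable-stable)

module _ {n : ℕ} {X : Subset n} {x : Fin n} where

  ∈-minus⁺ : ∀ {e} → x ∈ X → x ≢ e → x ∈ X minus e
  ∈-minus⁺ x∈X x≢e = x∈p∩q⁺ (x∈X , x∉p⇒x∈∁p (x≢y⇒x∉⁅y⁆ x≢e))

  ∈-minus⁻ : ∀ {e} → x ∈ X minus e → x ∈ X × x ≢ e
  ∈-minus⁻ {e} x∈X-e =
    let x∈X , x∈∁e = x∈p∩q⁻ X (∁ ⁅ e ⁆) x∈X-e in x∈X , x∉⁅y⁆⇒x≢y (x∈∁p⇒x∉p x∈∁e)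

  ∈-∪⁅⁆⁻ : ∀ {a} → x ∈ X ∪ ⁅ a ⁆ → x ∈ X ⊎ x ≡ a
  ∈-∪⁅⁆⁻ {a} x∈X+a with x∈p∪q⁻ X ⁅ a ⁆ x∈X+a
  ... | inj₁ x∈X = inj₁ x∈X
  ... | inj₂ x∈a = inj₂ (x∈⁅y⁆⇒x≡y a x∈a)

  ∈-∪⁅⁆ˡ : ∀ {a} → x ∈ X → x ∈ X ∪ ⁅ a ⁆
  ∈-∪⁅⁆ˡ x∈X = x∈p∪q⁺ (inj₁ x∈X)

  ∪⁅⁆-other : ∀ {a} → x ∈ X ∪ ⁅ a ⁆ → x ≢ a → x ∈ X
  ∪⁅⁆-other x∈X+a x≢a with ∈-∪⁅⁆⁻ x∈X+a
  ... | inj₁ x∈X = x∈X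
  ... | inj₂ x≡a = ⊥-elim (x≢a x≡a)

∈-∪⁅⁆ʳ : ∀ {n} {X : Subset n} {a} → a ∈ X ∪ ⁅ a ⁆
∈-∪⁅⁆ʳ {a = a} = x∈p∪q⁺ (inj₂ (x∈⁅x⁆ a))

∪⁅⁆-⊆ : ∀ {n} {X Y : Subset n} {a} → X ⊆ Y → a ∈ Y → X ∪ ⁅ a ⁆ ⊆ Y
∪⁅⁆-⊆ X⊆Y a∈Y x∈X+a with ∈-∪⁅⁆⁻ x∈X+a
... | inj₁ x∈X = X⊆Y x∈X
... | inj₂ refl = a∈Y

minus-⊆ : ∀ {n} {X Y : Subset n} {a} → X minus a ⊆ Y → a ∈ Y → X ⊆ Y
minus-⊆ {a = a} X-a⊆Y a∈Y {x} x∈X with x ≟ a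
... | yes refl = a∈Y
... | no x≢a = X-a⊆Y (∈-minus⁺ x∈X x≢a)

not-⊆-witness : ∀ {n} (X Y : Subset n) → ¬ (X ⊆ Y) → ∃ λ x → x ∈ X × x ∉ Y
not-⊆-witness X Y X⊈Y with nonempty? (X ∩ ∁ Y)
... | yes (x , x∈X∖Y) =
  let x∈X , x∈∁Y = x∈p∩q⁻ X (∁ Y) x∈X∖Y in x , x∈X , x∈∁p⇒x∉p x∈∁Y
... | no X∖Y-empty = ⊥-elim (X⊈Y λ {x} x∈X →
  decidable-stable (x ∈? Y) (λ x∉Y → X∖Y-empty (x , x∈p∩q⁺ (x∈X , x∉p⇒x∈∁p x∉Y))))

module _ {n : ℕ} {P : Fin n → Set} (P? : ∀ x → Dec (P x)) where

  private
    holds : ∀ {x} (P?x : Dec (P x)) → ⌊ P?x ⌋ ≡ true → P x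
    holds (yes px) _ = px
    holds (no _) ()

    decided : ∀ {x} (P?x : Dec (P x)) → P x → ⌊ P?x ⌋ ≡ true
    decided (yes _) _ = refl
    decided (no ¬px) px = ⊥-elim (¬px px)

  ∈-tabulate⁻ : ∀ {x} → x ∈ tabulate (λ i → ⌊ P? i ⌋) → P x
  ∈-tabulate⁻ {x} x∈ =
    holds (P? x) (trans (sym (lookup∘tabulate (λ i → ⌊ P? i ⌋) x)) ([]=⇒lookup x∈))

  ∈-tabulate⁺ : ∀ {x} → P x → x ∈ tabulate (λ i → ⌊ P? i ⌋)
  ∈-tabulate⁺ {x} px =
    lookup⇒[]= x _ (trans (lookup∘tabulate (λ i → ⌊ P? i ⌋) x) (decided (P? x) px))

card-insert : ∀ {n} (X : Subset n) {i} → i ∉ X → ∣ X ∪ ⁅ i ⁆ ∣ ≡ suc ∣ X ∣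
card-insert (inside ∷ X) {zero} i∉X = ⊥-elim (i∉X here)
card-insert (outside ∷ X) {zero} _ = cong (suc ∘ ∣_∣) (∪-identityʳ X)
card-insert (inside ∷ X) {suc i} i∉X = cong suc (card-insert X (i∉X ∘ there))
card-insert (outside ∷ X) {suc i} i∉X = card-insert X (i∉X ∘ there)

no-three-in-pair : ∀ {n} {P : Subset n} {a b c} → ∣ P ∣ ≡ 2 →
  a ∈ P → b ∈ P → c ∈ P → a ≢ b → a ≢ c → b ≢ c → ⊥
no-three-in-pair {P = P} {a} {b} {c} ∣P∣≡2 a∈P b∈P c∈P a≢b a≢c b≢c =
  3≰2 (subst₂ _≤_ ∣abc∣≡3 ∣P∣≡2 (p⊆q⇒∣p∣≤∣q∣ abc⊆P))
  where
  ∣ab∣≡2 : ∣ ⁅ a ⁆ ∪ ⁅ b ⁆ ∣ ≡ 2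
  ∣ab∣≡2 = trans (card-insert ⁅ a ⁆ (a≢b ∘ sym ∘ x∈⁅y⁆⇒x≡y a)) (cong suc (∣⁅x⁆∣≡1 a))
  c∉ab : c ∉ ⁅ a ⁆ ∪ ⁅ b ⁆
  c∉ab c∈ab with ∈-∪⁅⁆⁻ c∈ab
  ... | inj₁ c∈a = a≢c (sym (x∈⁅y⁆⇒x≡y a c∈a))
  ... | inj₂ c≡b = b≢c (sym c≡b)
  ∣abc∣≡3 : ∣ (⁅ a ⁆ ∪ ⁅ b ⁆) ∪ ⁅ c ⁆ ∣ ≡ 3
  ∣abc∣≡3 = trans (card-insert _ c∉ab) (cong suc ∣ab∣≡2)
  abc⊆P : (⁅ a ⁆ ∪ ⁅ b ⁆) ∪ ⁅ c ⁆ ⊆ P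
  abc⊆P = ∪⁅⁆-⊆ (∪⁅⁆-⊆ (λ x∈a → subst (_∈ P) (sym (x∈⁅y⁆⇒x≡y a x∈a)) a∈P) b∈P) c∈P
  3≰2 : ¬ (3 ≤ 2)
  3≰2 (s≤s (s≤s ()))

-- Between X ⊆ W there is a set of every size k with ∣ X ∣ ≤ k ≤ ∣ W ∣.
-- An element of W - X is taken into J exactly when the rest of W is too small.
sandwich : ∀ {n} (X W : Subset n) (k : ℕ) → X ⊆ W → ∣ X ∣ ≤ k → k ≤ ∣ W ∣ →
  ∃ λ J → X ⊆ J × J ⊆ W × ∣ J ∣ ≡ k
sandwich [] [] zero _ _ _ = [] , (λ ()) , (λ ()) , refl
sandwich (inside ∷ X) (outside ∷ W) k X⊆W _ _ with X⊆W here
... | ()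
sandwich (inside ∷ X) (inside ∷ W) (suc k) X⊆W (s≤s ∣X∣≤k) (s≤s k≤∣W∣)
  with sandwich X W k (drop-∷-⊆ X⊆W) ∣X∣≤k k≤∣W∣
... | J , X⊆J , J⊆W , ∣J∣≡k = inside ∷ J , in⊆in X⊆J , in⊆in J⊆W , cong suc ∣J∣≡k
sandwich (outside ∷ X) (outside ∷ W) k X⊆W ∣X∣≤k k≤∣W∣
  with sandwich X W k (drop-∷-⊆ X⊆W) ∣X∣≤k k≤∣W∣
... | J , X⊆J , J⊆W , ∣J∣≡k = outside ∷ J , out⊆ X⊆J , out⊆ J⊆W , ∣J∣≡k
sandwich (outside ∷ X) (inside ∷ W) k X⊆W ∣X∣≤k k≤1+∣W∣ with k ≤? ∣ W ∣
... | yes k≤∣W∣ with sandwich X W k (drop-∷-⊆ X⊆W) ∣X∣≤k k≤∣W∣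
...   | J , X⊆J , J⊆W , ∣J∣≡k = outside ∷ J , out⊆ X⊆J , out⊆ J⊆W , ∣J∣≡k
sandwich (outside ∷ X) (inside ∷ W) zero X⊆W ∣X∣≤k k≤1+∣W∣ | no k≰∣W∣ = ⊥-elim (k≰∣W∣ z≤n)
sandwich (outside ∷ X) (inside ∷ W) (suc k) X⊆W ∣X∣≤k (s≤s k≤∣W∣) | no k≰∣W∣
  with sandwich X W k (drop-∷-⊆ X⊆W)
         (≤-trans (p⊆q⇒∣p∣≤∣q∣ (drop-∷-⊆ X⊆W)) (s≤s⁻¹ (≰⇒> k≰∣W∣))) k≤∣W∣
... | J , X⊆J , J⊆W , ∣J∣≡k = inside ∷ J , out⊆ X⊆J , in⊆in J⊆W , cong suc ∣J∣≡k

_[_↦_] : ∀ {n} → Subset n → Fin n → Fin n → Subset n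
B [ g ↦ f ] = (B minus g) ∪ ⁅ f ⁆

exchanged-∉ : ∀ {n} {B : Subset n} {g f} → g ≢ f → g ∉ B [ g ↦ f ]
exchanged-∉ g≢f g∈B' = proj₂ (∈-minus⁻ (∪⁅⁆-other g∈B' g≢f)) refl

exchange-⊆ : ∀ {n} {B : Subset n} {g f} → B [ g ↦ f ] ⊆ B ∪ ⁅ f ⁆
exchange-⊆ = ∪⁅⁆-⊆ (λ x∈B-g → ∈-∪⁅⁆ˡ (proj₁ (∈-minus⁻ x∈B-g))) ∈-∪⁅⁆ʳ

⊆-exchange : ∀ {n} {B : Subset n} {g f} → B ⊆ B [ g ↦ f ] ∪ ⁅ g ⁆
⊆-exchange = minus-⊆ (λ x∈B-g → ∈-∪⁅⁆ˡ (∈-∪⁅⁆ˡ x∈B-g)) ∈-∪⁅⁆ʳ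

minus-⊆-exchange : ∀ {n} {X B : Subset n} {g f} → X ⊆ B ∪ ⁅ f ⁆ → X minus g ⊆ B [ g ↦ f ]
minus-⊆-exchange X⊆B+f x∈X-g with ∈-minus⁻ x∈X-g
... | x∈X , x≢g with ∈-∪⁅⁆⁻ (X⊆B+f x∈X)
...   | inj₁ x∈B = ∈-∪⁅⁆ˡ (∈-minus⁺ x∈B x≢g)
...   | inj₂ refl = ∈-∪⁅⁆ʳ

MeetAtMostIn : ∀ {n} → Fin n → Subset n → Subset n → Set
MeetAtMostIn e X Y = ∀ {x} → x ∈ X → x ∈ Y → x ≡ e

exchange-meets : ∀ {n} {B D : Subset n} {e g f} → MeetAtMostIn e B D → f ∉ D →
  MeetAtMostIn e (B [ g ↦ f ]) D
exchange-meets B∩D⊆e f∉D x∈B' x∈D with ∈-∪⁅⁆⁻ x∈B'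
... | inj₁ x∈B-g = B∩D⊆e (proj₁ (∈-minus⁻ x∈B-g)) x∈D
... | inj₂ refl = ⊥-elim (f∉D x∈D)

exchange-missing : ∀ {n} {B C : Subset n} {g f} → f ∈ C → f ∉ B → g ∉ C →
  ∣ C ∩ ∁ (B [ g ↦ f ]) ∣ < ∣ C ∩ ∁ B ∣
exchange-missing {B = B} {C} {g} {f} f∈C f∉B g∉C =
  p⊂q⇒∣p∣<∣q∣ (fewer , f , x∈p∩q⁺ (f∈C , x∉p⇒x∈∁p f∉B) , f-not-missing)
  where
  fewer : C ∩ ∁ (B [ g ↦ f ]) ⊆ C ∩ ∁ B
  fewer {y} y∈ with x∈p∩q⁻ C _ y∈
  ... | y∈C , y∉B' = x∈p∩q⁺ (y∈C , x∉p⇒x∈∁p y∉B)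
    where
    y∉B : y ∉ B
    y∉B y∈B with y ≟ g
    ... | yes refl = g∉C y∈C
    ... | no y≢g = x∈∁p⇒x∉p y∉B' (∈-∪⁅⁆ˡ (∈-minus⁺ y∈B y≢g))
  f-not-missing : f ∉ C ∩ ∁ (B [ g ↦ f ])
  f-not-missing f∈ = x∈∁p⇒x∉p (proj₂ (x∈p∩q⁻ C _ f∈)) ∈-∪⁅⁆ʳ

module MatroidTheory {n : ℕ} (M : Matroid n) where
  open Matroid M

  extension-dependent : ∀ {B f} → IsBasis M B → f ∉ B → ¬ Independent M (B ∪ ⁅ f ⁆)
  extension-dependent {B} bB f∉B indep =
    f∉B (subst (_ ∈_) (proj₂ bB (B ∪ ⁅ _ ⁆) indep ∈-∪⁅⁆ˡ) ∈-∪⁅⁆ʳ)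

  fundamental-through : ∀ {B f Cf} → IsBasis M B → IsCircuit Cf → Cf ⊆ B ∪ ⁅ f ⁆ → f ∈ Cf
  fundamental-through {B} {f} {Cf} bB cCf Cf⊆B+f = decidable-stable (f ∈? Cf) λ f∉Cf →
    proj₁ bB Cf cCf (λ x∈Cf → ∪⁅⁆-other (Cf⊆B+f x∈Cf) λ { refl → f∉Cf x∈Cf })

  -- Circuit elimination: if the circuit C has at most the element a outside S,
  -- any other circuit inside S ∪ {a} shows that S is dependent.
  pivot-dependent : ∀ {C D S a} → IsCircuit C → IsCircuit D → C ≢ D → a ∈ C →
    C minus a ⊆ S → D ⊆ S ∪ ⁅ a ⁆ → ¬ Independent M S
  pivot-dependent {C} {D} {S} {a} cC cD C≢D a∈C C-a⊆S D⊆S+a indS with a ∈? D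
  ... | no a∉D = indS D cD (λ x∈D → ∪⁅⁆-other (D⊆S+a x∈D) λ { refl → a∉D x∈D })
  ... | yes a∈D with C3 C D a cC cD C≢D a∈C a∈D
  ...   | F , cF , F⊆C∪D-a = indS F cF (λ x∈F → C∪D-a⊆S (F⊆C∪D-a x∈F))
    where
    C∪D-a⊆S : (C ∪ D) minus a ⊆ S
    C∪D-a⊆S x∈ with ∈-minus⁻ x∈
    ... | x∈C∪D , x≢a with x∈p∪q⁻ C D x∈C∪D
    ...   | inj₁ x∈C = C-a⊆S (∈-minus⁺ x∈C x≢a)
    ...   | inj₂ x∈D = ∪⁅⁆-other (D⊆S+a x∈D) x≢a

  exchange : ∀ {B f Cf g} → IsBasis M B → f ∉ B → IsCircuit Cf → Cf ⊆ B ∪ ⁅ f ⁆ →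
    g ∈ Cf → g ≢ f → IsBasis M (B [ g ↦ f ])
  exchange {B} {f} {Cf} {g} bB f∉B cCf Cf⊆B+f g∈Cf g≢f = independent , maximal
    where
    B' : Subset n
    B' = B [ g ↦ f ]
    f∈Cf : f ∈ Cf
    f∈Cf = fundamental-through bB cCf Cf⊆B+f
    g∉B' : g ∉ B'
    g∉B' = exchanged-∉ g≢f
    Cf-f⊆B : Cf minus f ⊆ B
    Cf-f⊆B x∈ = let x∈Cf , x≢f = ∈-minus⁻ x∈ in ∪⁅⁆-other (Cf⊆B+f x∈Cf) x≢f

    -- A circuit in B' would differ from Cf (it misses g) and eliminate f into B.
    independent : Independent M B'
    independent C' cC' C'⊆B' = pivot-dependent cCf cC'
      (λ { refl → g∉B' (C'⊆B' g∈Cf) }) f∈Cf Cf-f⊆B (exchange-⊆ ∘ C'⊆B') (proj₁ bB)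

    -- An independent I ⊋ B' contains some x ∉ B'; either x = g and Cf ⊆ I,
    -- or the circuit of B ∪ {x} eliminates g into I.
    maximal : ∀ I → Independent M I → B' ⊆ I → I ≡ B'
    maximal I indI B'⊆I with I ⊆? B'
    ... | yes I⊆B' = ⊆-antisym I⊆B' B'⊆I
    ... | no I⊈B' with not-⊆-witness I B' I⊈B'
    ...   | x , x∈I , x∉B' = ⊥-elim (outside-B' x∈I x∉B')
      where
      Cf-g⊆I : Cf minus g ⊆ I
      Cf-g⊆I x∈ = B'⊆I (minus-⊆-exchange Cf⊆B+f x∈)
      outside-B' : ∀ {x} → x ∈ I → x ∉ B' → ⊥
      outside-B' {x} x∈I x∉B' with x ≟ g
      ... | yes refl = indI Cf cCf (minus-⊆ Cf-g⊆I x∈I)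
      ... | no x≢g = extension-dependent bB x∉B λ Cx cCx Cx⊆B+x →
        pivot-dependent cCf cCx (Cf≢Cx Cx⊆B+x) g∈Cf Cf-g⊆I
          (λ y∈Cx → ∪⁅⁆-⊆ B⊆I+g (∈-∪⁅⁆ˡ x∈I) (Cx⊆B+x y∈Cx)) indI
        where
        x∉B : x ∉ B
        x∉B x∈B = x∉B' (∈-∪⁅⁆ˡ (∈-minus⁺ x∈B x≢g))
        B⊆I+g : B ⊆ I ∪ ⁅ g ⁆
        B⊆I+g y∈B = ∪⁅⁆-⊆ (λ y∈B' → ∈-∪⁅⁆ˡ (B'⊆I y∈B')) ∈-∪⁅⁆ʳ (⊆-exchange y∈B)
        Cf≢Cx : ∀ {Cx} → Cx ⊆ B ∪ ⁅ x ⁆ → Cf ≢ Cx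
        Cf≢Cx Cx⊆B+x refl with ∈-∪⁅⁆⁻ (Cx⊆B+x f∈Cf)
        ... | inj₁ f∈B = f∉B f∈B
        ... | inj₂ refl = x∉B' ∈-∪⁅⁆ʳ

  module _ {C D : Subset n} {e : Fin n} (cC : IsCircuit C) (D-meets : MeetsAllBases M D)
           (e∈C : e ∈ C) (C∩D⊆e : MeetAtMostIn e C D) where

    -- A basis B with B ∩ D ⊆ {e} can be exchanged for another one missing
    -- fewer elements of C (stated in continuation form, as the circuit of
    -- B ∪ {f} is only known to exist by contradiction).
    closer-basis : ∀ {B} → IsBasis M B → MeetAtMostIn e B D →
      ¬ (∀ B' → IsBasis M B' → MeetAtMostIn e B' D → ∣ C ∩ ∁ B' ∣ < ∣ C ∩ ∁ B ∣ → ⊥)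
    closer-basis {B} bB B∩D⊆e no-closer with not-⊆-witness C B (proj₁ bB C cC)
    ... | f , f∈C , f∉B = extension-dependent bB f∉B fundamental
      where
      e∈B : e ∈ B
      e∈B with D-meets B bB
      ... | x , x∈D∩B = let x∈D , x∈B = x∈p∩q⁻ D B x∈D∩B in subst (_∈ B) (B∩D⊆e x∈B x∈D) x∈B
      f∉D : f ∉ D
      f∉D f∈D with C∩D⊆e f∈C f∈D
      ... | refl = f∉B e∈B
      e≢f : e ≢ f
      e≢f refl = f∉B e∈B
      -- Through e, the exchange B - e + f would avoid D entirely; otherwise some
      -- g ∈ Cf - C can be exchanged, bringing the basis closer to C.
      fundamental : (Cf : Subset n) → IsCircuit Cf → ¬ (Cf ⊆ B ∪ ⁅ f ⁆)
      fundamental Cf cCf Cf⊆B+f with e ∈? Cf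
      ... | yes e∈Cf with D-meets _ (exchange bB f∉B cCf Cf⊆B+f e∈Cf e≢f)
      ...   | x , x∈D∩B' with x∈p∩q⁻ D _ x∈D∩B'
      ...     | x∈D , x∈B' with exchange-meets B∩D⊆e f∉D x∈B' x∈D
      ...       | refl = exchanged-∉ e≢f x∈B'
      fundamental Cf cCf Cf⊆B+f | no e∉Cf with not-⊆-witness Cf C Cf⊈C
        where
        Cf⊈C : ¬ (Cf ⊆ C)
        Cf⊈C Cf⊆C = e∉Cf (subst (e ∈_) (sym (C2 Cf C cCf cC Cf⊆C)) e∈C)
      ... | g , g∈Cf , g∉C = no-closer _ (exchange bB f∉B cCf Cf⊆B+f g∈Cf g≢f)
        (exchange-meets B∩D⊆e f∉D) (exchange-missing f∈C f∉B g∉C)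
        where
        g≢f : g ≢ f
        g≢f refl = g∉C f∈C

    no-basis-meets-at-most : ∀ B → IsBasis M B → MeetAtMostIn e B D → ⊥
    no-basis-meets-at-most B = <-rec P step ∣ C ∩ ∁ B ∣ B refl
      where
      P : ℕ → Set
      P k = ∀ B → ∣ C ∩ ∁ B ∣ ≡ k → IsBasis M B → MeetAtMostIn e B D → ⊥
      step : ∀ k → (∀ {j} → j < k → P j) → P k
      step _ ih B refl bB B∩D⊆e =
        closer-basis bB B∩D⊆e (λ B' bB' B'∩D⊆e closer → ih closer B' refl bB' B'∩D⊆e)

  orthogonality : ∀ {C D e} → IsCircuit C → IsCocircuit M D → e ∈ C → e ∈ D →
    MeetAtMostIn e C D → ⊥
  orthogonality {C} {D} {e} cC (D-meets , D-minimal) e∈C e∈D C∩D⊆e =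
    proj₂ (∈-minus⁻ (subst (e ∈_) (sym D-e≡D) e∈D)) refl
    where
    D-e-meets : MeetsAllBases M (D minus e)
    D-e-meets B bB with nonempty? ((D minus e) ∩ B)
    ... | yes nonempty = nonempty
    ... | no empty = ⊥-elim (no-basis-meets-at-most cC D-meets e∈C C∩D⊆e B bB
      λ {x} x∈B x∈D → decidable-stable (x ≟ e) λ x≢e →
        empty (x , x∈p∩q⁺ (∈-minus⁺ x∈D x≢e , x∈B)))
    D-e≡D : D minus e ≡ D
    D-e≡D = D-minimal (D minus e) D-e-meets (proj₁ ∘ ∈-minus⁻)

module Blocks {n r : ℕ} (p : Fin n → Fin r) where

  ∈-block⁻ : ∀ {i x} → x ∈ block p i → p x ≡ i
  ∈-block⁻ {i} = ∈-tabulate⁻ (λ e → p e ≟ i)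

  ∈-block⁺ : ∀ {x} → x ∈ block p (p x)
  ∈-block⁺ {x} = ∈-tabulate⁺ (λ e → p e ≟ p x) refl

  ∈-blockUnion⁻ : ∀ {J x} → x ∈ blockUnion p J → p x ∈ J
  ∈-blockUnion⁻ {J} {x} x∈ =
    lookup⇒[]= (p x) J (trans (sym (lookup∘tabulate (lookup J ∘ p) x)) ([]=⇒lookup x∈))

  ∈-blockUnion⁺ : ∀ {J x} → p x ∈ J → x ∈ blockUnion p J
  ∈-blockUnion⁺ {J} {x} px∈J =
    lookup⇒[]= x _ (trans (lookup∘tabulate (lookup J ∘ p) x) ([]=⇒lookup px∈J))

  containedIn meeting : Subset n → Subset r
  containedIn C = tabulate (λ i → ⌊ block p i ⊆? C ⌋)
  meeting C = tabulate (λ i → ⌊ nonempty? (block p i ∩ C) ⌋)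

  ∈-meeting : ∀ {C x} → x ∈ C → p x ∈ meeting C
  ∈-meeting {C} {x} x∈C =
    ∈-tabulate⁺ (λ i → nonempty? (block p i ∩ C)) (x , x∈p∩q⁺ (∈-block⁺ , x∈C))

  blockUnion-⊆ : ∀ {C J} → J ⊆ containedIn C → blockUnion p J ⊆ C
  blockUnion-⊆ {C} J⊆ x∈ = ∈-tabulate⁻ (λ i → block p i ⊆? C) (J⊆ (∈-blockUnion⁻ x∈)) ∈-block⁺

  ⊆-blockUnion : ∀ {C J} → meeting C ⊆ J → C ⊆ blockUnion p J
  ⊆-blockUnion meeting⊆J x∈C = ∈-blockUnion⁺ (meeting⊆J (∈-meeting x∈C))

-- Room for the cocircuit: if m + t ≤ r + 1 (i.e. ¬ r + 2 ≤ m + t) and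
-- m ≤ r, then t ≤ (r - m) + 1.
room-for-indices : ∀ {r m t} → m ≤ r → ¬ (r + 2 ≤ m + t) → t ≤ suc (r ∸ m)
room-for-indices {r} {m} {t} m≤r few =
  subst (t ≤_) (+-∸-assoc 1 m≤r) (m+n≤o⇒m≤o∸n t (subst (_≤ suc r) (+-comm m t) m+t≤1+r))
  where
  m+t≤1+r : m + t ≤ suc r
  m+t≤1+r = s≤s⁻¹ (subst (suc (m + t) ≤_) (+-comm r 2) (≰⇒> few))

module Spike {n t r : ℕ} {M : Matroid n} {p : Fin n → Fin r} (S : IsSpike M t r p) where
  open Matroid M
  open IsSpike S
  open MatroidTheory M
  open Blocks p

  circuit-with-t-blocks : ∀ {C} → IsCircuit C → t ≤ ∣ containedIn C ∣ →
    ∃ λ J → ∣ J ∣ ≡ t × C ≡ blockUnion p J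
  circuit-with-t-blocks {C} cC t≤∣X∣
    with sandwich ∅ (containedIn C) t (⊆-min _) (subst (_≤ t) (sym (∣⊥∣≡0 r)) z≤n) t≤∣X∣
  ... | J , _ , J⊆X , ∣J∣≡t =
    J , ∣J∣≡t , sym (C2 _ C (spike-circ J ∣J∣≡t) cC (blockUnion-⊆ J⊆X))

  circuit-of-blocks : ∀ {C} → IsCircuit C → ∣ containedIn C ∣ ≤ t →
    meeting C ⊆ containedIn C → ∃ λ J → ∣ J ∣ ≡ t × C ≡ blockUnion p J
  circuit-of-blocks {C} cC ∣X∣≤t Y⊆X
    with sandwich (containedIn C) ⊤ t ⊆⊤ ∣X∣≤t (subst (t ≤_) (sym (∣⊤∣≡n r)) t≤r)
  ... | J , X⊆J , _ , ∣J∣≡t =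
    J , ∣J∣≡t , C2 C _ cC (spike-circ J ∣J∣≡t) (⊆-blockUnion (⊆-trans Y⊆X X⊆J))

  cocircuit-indices : ∀ {C i} → 1 ≤ t → i ∈ meeting C → ¬ (r + 2 ≤ ∣ meeting C ∣ + t) →
    ∃ λ J → i ∈ J × J ⊆ ∁ (meeting C) ∪ ⁅ i ⁆ × ∣ J ∣ ≡ t
  cocircuit-indices {C} {i} 1≤t i∈Y few
    with sandwich ⁅ i ⁆ (∁ (meeting C) ∪ ⁅ i ⁆) t (x∈p∪q⁺ ∘ inj₂)
           (subst (_≤ t) (sym (∣⁅x⁆∣≡1 i)) 1≤t) t≤∣W∣
    where
    t≤∣W∣ : t ≤ ∣ ∁ (meeting C) ∪ ⁅ i ⁆ ∣
    t≤∣W∣ = subst (t ≤_)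
      (sym (trans (card-insert _ (x∈p⇒x∉∁p i∈Y)) (cong suc (∣∁p∣≡n∸∣p∣ (meeting C)))))
      (room-for-indices (∣p∣≤n (meeting C)) few)
  ... | J , i⊆J , J⊆W , ∣J∣≡t = J , i⊆J (x∈⁅x⁆ i) , J⊆W , ∣J∣≡t

  -- The heart of the lemma: if fewer than r - (t - 2) blocks meet the circuit
  -- C, each block meeting C lies in C. Otherwise a block A_i = {e, e'} with
  -- e ∈ C and e' ∉ C lets C meet the cocircuit A_J of cocircuit-indices in e alone.
  few-meetings⇒whole-blocks : ∀ {C} → 1 ≤ t → IsCircuit C →
    ¬ (r + 2 ≤ ∣ meeting C ∣ + t) → meeting C ⊆ containedIn C
  few-meetings⇒whole-blocks {C} 1≤t cC few {i} i∈Y with block p i ⊆? C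
  ... | yes Ai⊆C = ∈-tabulate⁺ (λ j → block p j ⊆? C) Ai⊆C
  ... | no Ai⊈C
    with ∈-tabulate⁻ (λ j → nonempty? (block p j ∩ C)) i∈Y | not-⊆-witness _ C Ai⊈C
       | cocircuit-indices 1≤t i∈Y few
  ... | e , e∈Ai∩C | e' , e'∈Ai , e'∉C | J , i∈J , J⊆W , ∣J∣≡t =
    ⊥-elim (orthogonality cC (spike-cocirc J ∣J∣≡t) e∈C e∈AJ only-e)
    where
    e∈Ai : e ∈ block p i
    e∈Ai = proj₁ (x∈p∩q⁻ (block p i) C e∈Ai∩C)
    e∈C : e ∈ C
    e∈C = proj₂ (x∈p∩q⁻ (block p i) C e∈Ai∩C)
    e∈AJ : e ∈ blockUnion p J
    e∈AJ = ∈-blockUnion⁺ (subst (_∈ J) (sym (∈-block⁻ e∈Ai)) i∈J)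
    only-e : MeetAtMostIn e C (blockUnion p J)
    only-e {x} x∈C x∈AJ with ∈-∪⁅⁆⁻ (J⊆W (∈-blockUnion⁻ x∈AJ))
    ... | inj₁ px∉Y = ⊥-elim (x∈∁p⇒x∉p px∉Y (∈-meeting x∈C))
    ... | inj₂ refl = decidable-stable (x ≟ e) λ x≢e →
      no-three-in-pair (blocks-pairs (p x)) ∈-block⁺ e∈Ai e'∈Ai x≢e
        (λ { refl → e'∉C x∈C }) (λ { refl → e'∉C e∈C })

lemma6p3 : ∀ {n : ℕ} (t r : ℕ) → 1 ≤ t → (M : Matroid n) (p : Fin n → Fin r) →
    IsSpike M t r p → (C : Subset n) → Matroid.IsCircuit M C →
    (∃ λ (J : Subset r) → ∣ J ∣ ≡ t × C ≡ blockUnion p J)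
    ⊎ ((r + 2 ≤ numMeeting p C + t) × numContained p C < t)
lemma6p3 t r 1≤t M p S C cC with t ≤? numContained p C
... | yes t≤∣X∣ = inj₁ (Spike.circuit-with-t-blocks S cC t≤∣X∣)
... | no t≰∣X∣ with r + 2 ≤? numMeeting p C + t
...   | yes many = inj₂ (many , ≰⇒> t≰∣X∣)
...   | no few = inj₁ (Spike.circuit-of-blocks S cC (<⇒≤ (≰⇒> t≰∣X∣))
                        (Spike.few-meetings⇒whole-blocks S 1≤t cC few))
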